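{- Let $\mathbf A$ be a bounded K-lattice such that $\mathbf K_4$ is not isomorphic to any subalgebra of $\mathbf A$. Then for every $\mathbf B\in\mathbb S\mathbb P_u(\mathbf A)$ (subalgebras of ultrapowers of $\mathbf A$), $\mathbf K_4$ is not isomorphic to any subalgebra of $\mathbf B$.
   Context: With $\sim x:=x\to1$, a bounded K-lattice is a commutative residuated lattice $(A,\vee,\wedge,\cdot,\to,1)$ (lattice, commutative monoid, $ab\le c$ iff $a\le b\to c$) with an extra constant $0\le x$, satisfying $\sim\sim x=x$, the lattice distributive laws whenever one of the three elements is $1$, and $xy\wedge 1=(x\wedge1)(y\wedge1)$, $((x\wedge1)\to y)\wedge((\sim y\wedge 1)\to\sim x)=x\to y$. For a bounded commutative residuated lattice $\mathbf L$, $K(\mathbf L)$ is the algebra on $L\times L$ with $(a,b)\vee(c,d)=(a\vee c,b\wedge d)$, $(a,b)\wedge(c,d)=(a\wedge c,b\vee d)$, $(a,b)(c,d)=(ac,(a\to d)\wedge(c\to b))$, $(a,b)\to(c,d)=((a\to c)\wedge(d\to b),ad)$, unit $(1,1)$, constant $0$ as $(0,1)$. $\mathbf K_4=K(\mathbf 2)$ with $\mathbf 2$ the two-element Boolean algebra. -}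

module Defs where

open import Data.Bool using (Bool; true; false) renaming (_∧_ to _&&_; _∨_ to _||_; not to bnot)
open import Data.Product using (Σ; _×_; _,_; proj₁; proj₂)
open import Data.Sum using (_⊎_)
open import Data.Unit using (⊤; tt)
open import Data.Empty using (⊥)
open import Relation.Nullary using (¬_)
open import Relation.Binary.Core using (Rel)
open import Relation.Binary.Structures using (IsEquivalence)
open import Relation.Binary.PropositionalEquality using (_≡_; refl; cong₂) renaming (isEquivalence to ≡-isEquivalence)
open import Algebra.Definitions using (Congruent₂)

record Algebra : Set₁ where
  infixr 6 _∨_
  infixr 7 _∧_
  infixr 8 _·_
  infixr 5 _⇒_
  infix 4 _≈_
  field
    Carrier : Set
    _≈_ : Rel Carrier _
    isEquivalence : IsEquivalence _≈_
    _∨_ _∧_ _·_ _⇒_ : Carrier → Carrier → Carrier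
    one zero : Carrier
    ∨-cong : Congruent₂ _≈_ _∨_
    ∧-cong : Congruent₂ _≈_ _∧_
    ·-cong : Congruent₂ _≈_ _·_
    ⇒-cong : Congruent₂ _≈_ _⇒_

  _≤_ : Carrier → Carrier → Set
  x ≤ y = (x ∧ y) ≈ x

  ∼_ : Carrier → Carrier
  ∼ x = x ⇒ one

record IsBoundedKLattice (A : Algebra) : Set where
  open Algebra A
  field
    ∨-comm : ∀ x y → x ∨ y ≈ y ∨ x
    ∧-comm : ∀ x y → x ∧ y ≈ y ∧ x
    ∨-assoc : ∀ x y z → (x ∨ y) ∨ z ≈ x ∨ (y ∨ z)
    ∧-assoc : ∀ x y z → (x ∧ y) ∧ z ≈ x ∧ (y ∧ z)
    ∨-absorbs-∧ : ∀ x y → x ∨ (x ∧ y) ≈ x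
    ∧-absorbs-∨ : ∀ x y → x ∧ (x ∨ y) ≈ x
    ·-comm : ∀ x y → x · y ≈ y · x
    ·-assoc : ∀ x y z → (x · y) · z ≈ x · (y · z)
    ·-identityˡ : ∀ x → one · x ≈ x
    residuated₁ : ∀ x y z → (x · y) ≤ z → x ≤ (y ⇒ z)
    residuated₂ : ∀ x y z → x ≤ (y ⇒ z) → (x · y) ≤ z
    zero-least : ∀ x → zero ≤ x
    ∼∼ : ∀ x → ∼ (∼ x) ≈ x
    ∧-distrib-1₁ : ∀ y z → one ∧ (y ∨ z) ≈ (one ∧ y) ∨ (one ∧ z)
    ∧-distrib-1₂ : ∀ x z → x ∧ (one ∨ z) ≈ (x ∧ one) ∨ (x ∧ z)
    ∧-distrib-1₃ : ∀ x y → x ∧ (y ∨ one) ≈ (x ∧ y) ∨ (x ∧ one)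
    ∨-distrib-1₁ : ∀ y z → one ∨ (y ∧ z) ≈ (one ∨ y) ∧ (one ∨ z)
    ∨-distrib-1₂ : ∀ x z → x ∨ (one ∧ z) ≈ (x ∨ one) ∧ (x ∨ z)
    ∨-distrib-1₃ : ∀ x y → x ∨ (y ∧ one) ≈ (x ∨ y) ∧ (x ∨ one)
    K₁ : ∀ x y → (x · y) ∧ one ≈ (x ∧ one) · (y ∧ one)
    K₂ : ∀ x y → ((x ∧ one) ⇒ y) ∧ (((∼ y) ∧ one) ⇒ (∼ x)) ≈ x ⇒ y

-- Embeddings (injective homomorphisms) = isomorphisms onto a subalgebra.

record Embedding (A B : Algebra) : Set where
  module A = Algebra A
  module B = Algebra B
  field
    f : A.Carrier → B.Carrier
    f-cong : ∀ {x y} → x A.≈ y → f x B.≈ f y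
    f-inj : ∀ {x y} → f x B.≈ f y → x A.≈ y
    pres-∨ : ∀ x y → f (x A.∨ y) B.≈ (f x B.∨ f y)
    pres-∧ : ∀ x y → f (x A.∧ y) B.≈ (f x B.∧ f y)
    pres-· : ∀ x y → f (x A.· y) B.≈ (f x B.· f y)
    pres-⇒ : ∀ x y → f (x A.⇒ y) B.≈ (f x B.⇒ f y)
    pres-one : f A.one B.≈ B.one
    pres-zero : f A.zero B.≈ B.zero

-- K4 = K(2), 2 the two-element Boolean algebra (· = ∧, → = implication).

_⇒𝟚_ : Bool → Bool → Bool
a ⇒𝟚 b = bnot a || b

K4 : Algebra
K4 = record
  { Carrier = Bool × Bool
  ; _≈_ = _≡_
  ; isEquivalence = ≡-isEquivalence
  ; _∨_ = λ { (a , b) (c , d) → (a || c , b && d) }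
  ; _∧_ = λ { (a , b) (c , d) → (a && c , b || d) }
  ; _·_ = λ { (a , b) (c , d) → (a && c , (a ⇒𝟚 d) && (c ⇒𝟚 b)) }
  ; _⇒_ = λ { (a , b) (c , d) → ((a ⇒𝟚 c) && (d ⇒𝟚 b) , a && d) }
  ; one = (true , true)
  ; zero = (false , true)
  ; ∨-cong = λ { refl refl → refl }
  ; ∧-cong = λ { refl refl → refl }
  ; ·-cong = λ { refl refl → refl }
  ; ⇒-cong = λ { refl refl → refl }
  }

record Ultrafilter (I : Set) : Set₁ where
  field
    U : (I → Set) → Set
    full : U (λ _ → ⊤)
    proper : ¬ U (λ _ → ⊥)
    upward : ∀ {S T : I → Set} → (∀ i → S i → T i) → U S → U T
    meet : ∀ {S T : I → Set} → U S → U T → U (λ i → S i × T i)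
    ultra : ∀ (S : I → Set) → U S ⊎ U (λ i → ¬ S i)

Ultrapower : (A : Algebra) (I : Set) → Ultrafilter I → Algebra
Ultrapower A I 𝒰 = record
  { Carrier = I → A.Carrier
  ; _≈_ = _≈U_
  ; isEquivalence = record
      { refl = upward (λ i _ → A.refl) full
      ; sym = upward (λ i → A.sym)
      ; trans = λ p q → upward (λ i pq → A.trans (proj₁ pq) (proj₂ pq)) (meet p q)
      }
  ; _∨_ = λ x y i → x i A.∨ y i
  ; _∧_ = λ x y i → x i A.∧ y i
  ; _·_ = λ x y i → x i A.· y i
  ; _⇒_ = λ x y i → x i A.⇒ y i
  ; one = λ _ → A.one
  ; zero = λ _ → A.zero
  ; ∨-cong = λ p q → upward (λ i pq → A.∨-cong (proj₁ pq) (proj₂ pq)) (meet p q)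
  ; ∧-cong = λ p q → upward (λ i pq → A.∧-cong (proj₁ pq) (proj₂ pq)) (meet p q)
  ; ·-cong = λ p q → upward (λ i pq → A.·-cong (proj₁ pq) (proj₂ pq)) (meet p q)
  ; ⇒-cong = λ p q → upward (λ i pq → A.⇒-cong (proj₁ pq) (proj₂ pq)) (meet p q)
  }
  where
    module A where
      open Algebra A public
      open IsEquivalence isEquivalence public
    open Ultrafilter 𝒰
    _≈U_ : (I → A.Carrier) → (I → A.Carrier) → Set
    x ≈U y = U (λ i → x i A.≈ y i)

InSPu : Algebra → Algebra → Set₁
InSPu A B = Σ Set λ I → Σ (Ultrafilter I) λ 𝒰 → Embedding B (Ultrapower A I 𝒰)

-- K4 is finite, so "f is an embedding of K4" is a finite conjunction of equations and
-- implications between equations of A.  By the ultrafilter properties such a conjunction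
-- holds coordinatewise on a U-large set of indices whenever it holds in A^I/U (a finite
-- instance of Łoś's theorem), and any such coordinate yields an embedding of K4 into A.
-- Embeddings compose, so the claim passes from the ultrapower to its subalgebras.
module Submission where

open import Defs
open import Data.Bool using (Bool; true; false)
open import Data.Empty using (⊥; ⊥-elim)
open import Data.List using (List; []; _∷_)
open import Data.List.Membership.Propositional using (_∈_)
open import Data.List.Relation.Unary.All as All using (All; []; _∷_)
open import Data.List.Relation.Unary.Any using (here; there)
open import Data.Product using (_×_; _,_)
open import Data.Sum using (inj₁; inj₂)
open import Relation.Binary.PropositionalEquality using (refl)
open import Relation.Binary.Structures using (IsEquivalence)
open import Relation.Nullary using (¬_)

Embedding-∘ : ∀ {A B C} → Embedding B C → Embedding A B → Embedding A C
Embedding-∘ {C = C} g f = record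
  { f = λ x → G.f (F.f x)
  ; f-cong = λ p → G.f-cong (F.f-cong p)
  ; f-inj = λ p → F.f-inj (G.f-inj p)
  ; pres-∨ = λ x y → C.trans (G.f-cong (F.pres-∨ x y)) (G.pres-∨ _ _)
  ; pres-∧ = λ x y → C.trans (G.f-cong (F.pres-∧ x y)) (G.pres-∧ _ _)
  ; pres-· = λ x y → C.trans (G.f-cong (F.pres-· x y)) (G.pres-· _ _)
  ; pres-⇒ = λ x y → C.trans (G.f-cong (F.pres-⇒ x y)) (G.pres-⇒ _ _)
  ; pres-one = C.trans (G.f-cong F.pres-one) G.pres-one
  ; pres-zero = C.trans (G.f-cong F.pres-zero) G.pres-zero
  }
  where
    module F = Embedding f
    module G = Embedding g
    module C = IsEquivalence (Algebra.isEquivalence C)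

module UltrafilterProperties {I : Set} (𝒰 : Ultrafilter I) where
  open Ultrafilter 𝒰

  U-All : ∀ {X : Set} {S : X → I → Set} (xs : List X) →
          (∀ x → U (S x)) → U (λ i → All (λ x → S x i) xs)
  U-All [] _ = upward (λ _ _ → []) full
  U-All (x ∷ xs) large = upward (λ _ (p , ps) → p ∷ ps) (meet (large x) (U-All xs large))

  U-∀-listed : ∀ {X : Set} {S : X → I → Set} (xs : List X) → (∀ x → x ∈ xs) →
               (∀ x → U (S x)) → U (λ i → ∀ x → S x i)
  U-∀-listed xs complete large =
    upward (λ _ all x → All.lookup all (complete x)) (U-All xs large)

  U-∀²-listed : ∀ {X : Set} {S : X → X → I → Set} (xs : List X) → (∀ x → x ∈ xs) →
                (∀ x y → U (S x y)) → U (λ i → ∀ x y → S x y i)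
  U-∀²-listed xs complete large =
    U-∀-listed xs complete (λ x → U-∀-listed xs complete (large x))

  -- Q need not be decidable, so split on S instead: if its complement is large, Q is refuted.
  U-const→ : ∀ {Q : Set} {S : I → Set} → (Q → U S) → U (λ i → Q → S i)
  U-const→ {Q} {S} large-if with ultra S
  ... | inj₁ S-large = upward (λ _ s _ → s) S-large
  ... | inj₂ ¬S-large = upward (λ _ _ q → ⊥-elim (¬Q q)) full
    where
      ¬Q : ¬ Q
      ¬Q q = proper (upward (λ _ (¬s , s) → ¬s s) (meet ¬S-large (large-if q)))

  U-→const : ∀ {Q : Set} {S : I → Set} → (U S → Q) → U (λ i → S i → Q)
  U-→const {S = S} reflects with ultra S
  ... | inj₁ S-large = upward (λ _ _ _ → reflects S-large) full
  ... | inj₂ ¬S-large = upward (λ _ ¬s s → ⊥-elim (¬s s)) ¬S-large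

module _ (A : Algebra) {I : Set} (𝒰 : Ultrafilter I) (F : Algebra) where
  open Ultrafilter 𝒰
  open UltrafilterProperties 𝒰
  private
    module A = Algebra A
    module F = Algebra F

  IsEmbeddingAt : (F.Carrier → I → A.Carrier) → I → Set
  IsEmbeddingAt f i =
    ((∀ x y → x F.≈ y → f x i A.≈ f y i) × (∀ x y → f x i A.≈ f y i → x F.≈ y)) ×
    ((∀ x y → f (x F.∨ y) i A.≈ (f x i A.∨ f y i)) × (∀ x y → f (x F.∧ y) i A.≈ (f x i A.∧ f y i))) ×
    ((∀ x y → f (x F.· y) i A.≈ (f x i A.· f y i)) × (∀ x y → f (x F.⇒ y) i A.≈ (f x i A.⇒ f y i))) ×
    (f F.one i A.≈ A.one × f F.zero i A.≈ A.zero)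

  embedding-at : ∀ f i → IsEmbeddingAt f i → Embedding F A
  embedding-at f i ((cong , inj) , (p∨ , p∧) , (p· , p⇒) , (p1 , p0)) = record
    { f = λ x → f x i ; f-cong = cong _ _ ; f-inj = inj _ _
    ; pres-∨ = p∨ ; pres-∧ = p∧ ; pres-· = p· ; pres-⇒ = p⇒
    ; pres-one = p1 ; pres-zero = p0 }

  module _ (elements : List F.Carrier) (complete : ∀ x → x ∈ elements) where

    large-IsEmbeddingAt : (e : Embedding F (Ultrapower A I 𝒰)) → U (IsEmbeddingAt (Embedding.f e))
    large-IsEmbeddingAt e =
      meet (meet (∀² (λ x y → U-const→ E.f-cong)) (∀² (λ x y → U-→const E.f-inj)))
        (meet (meet (∀² E.pres-∨) (∀² E.pres-∧))
          (meet (meet (∀² E.pres-·) (∀² E.pres-⇒))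
            (meet E.pres-one E.pres-zero)))
      where
        module E = Embedding e
        ∀² : ∀ {S : F.Carrier → F.Carrier → I → Set} → (∀ x y → U (S x y)) → U (λ i → ∀ x y → S x y i)
        ∀² = U-∀²-listed elements complete

    ¬Embedding-ultrapower : ¬ Embedding F A → ¬ Embedding F (Ultrapower A I 𝒰)
    ¬Embedding-ultrapower ¬e e =
      proper (upward (λ i at → ¬e (embedding-at (Embedding.f e) i at)) (large-IsEmbeddingAt e))

K4-elements : List (Bool × Bool)
K4-elements = (true , true) ∷ (true , false) ∷ (false , true) ∷ (false , false) ∷ []

∈-K4-elements : ∀ x → x ∈ K4-elements
∈-K4-elements (true , true) = here refl
∈-K4-elements (true , false) = there (here refl)
∈-K4-elements (false , true) = there (there (here refl))
∈-K4-elements (false , false) = there (there (there (here refl)))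

-- The K-lattice hypothesis is unused: only the finiteness of K4 matters.
lemma2p10 : (A : Algebra) → IsBoundedKLattice A → ¬ Embedding K4 A →
    (B : Algebra) → InSPu A B → ¬ Embedding K4 B
lemma2p10 A _ ¬K4↪A B (I , 𝒰 , B↪Aᴵ) K4↪B =
  ¬Embedding-ultrapower A 𝒰 K4 K4-elements ∈-K4-elements ¬K4↪A (Embedding-∘ B↪Aᴵ K4↪B)
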